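{- Work in the "linear" axiomatic framework for three-dimensional projective space described in the context, assuming Axioms [1]–[4] together with Axiom [H]. Let $O,P,Q,R$ be the vertices of a complete quadrangle, and let $A$, $B$, $C$ be its diagonal points, namely $A$ is the intersection point of the lines $OP$ and $QR$, $B$ that of $OQ$ and $RP$, and $C$ that of $OR$ and $PQ$. Then $A, B, C$ are not collinear.
   Context: Let $\mathbb{L}$ be a set (whose elements are called lines) with a symmetric reflexive relation $\sim$ (incidence). Lines that are not incident are called skew. For $S \subseteq \mathbb{L}$ let $S^{\sim}$ be the set of all lines incident to every line of $S$, and write $[l_1 \dots l_n] = \{l_1,\dots,l_n\}^{\sim}$. The axioms are: Axiom [1]: for each line $l$, the set $\{l\}^{\sim}$ contains three pairwise skew lines. Axiom [2]: for each incident pair of distinct lines $a,b$: (2.1) $[ab]$ contains skew pairs of lines; (2.2) if $c \in [ab]\setminus[ab]^{\sim}$ is one of such a skew pair, then no skew pairs lie in $[abc]$; (2.3) if $x,y$ is a skew pair in $[ab]$ then $[ab] = [abx]\cup[aby]$. Axiom [3]: if $a,b$ is an incident line pair and $c \in [ab]\setminus[ab]^{\sim}$, then there exist an incident line pair $p,q$ and $r \in [pq]\setminus[pq]^{\sim}$ with $[abc]\cap[pqr]=\emptyset$. For incident distinct lines $a,b$ put $\Sigma(a,b) = [ab]\setminus[ab]^{\sim}$; incidence restricted to $\Sigma(a,b)$ is an equivalence relation with exactly two classes, which (as part of the structure) are labelled $\Sigma_{\mathrm{pt}}(a,b)$ and $\Sigma_{\mathrm{pl}}(a,b)$. The point $\mathrm{pt}(a,b)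 = [abc]$ with $c \in \Sigma_{\mathrm{pt}}(a,b)$ and the plane $\mathrm{pl}(a,b) = [abc]$ with $c \in \Sigma_{\mathrm{pl}}(a,b)$ are independent of the choice of $c$. Axiom [4]: whenever $a,b$ and $p,q$ are pairs of distinct incident lines, $\mathrm{pt}(a,b)\cap\mathrm{pt}(p,q)\neq\emptyset$ and $\mathrm{pl}(a,b)\cap\mathrm{pl}(p,q)\neq\emptyset$. Points are the sets $\mathrm{pt}(a,b)$ and planes the sets $\mathrm{pl}(a,b)$ ($a\ne b$ incident); a line lies on a point/plane if it is an element of it. A point and a plane are incident if their intersection is nonempty. Points are collinear if some line lies in all of them; points are coplanar if they are all incident with one plane. Two distinct points $X,Y$ have exactly one common line, denoted $XY$; two distinct coplanar lines $\ell, m$ are incident and lie in a unique common point, their intersection point. A complete quadrangle is a set of four coplanar points $O,P,Q,R$, no three of which are collinear. A triad is a triple of pairwise-incident lines $a,b,c$ with $c \in \Sigma(a,b)$ (equivalently $a\in\Sigma(b,c)$, equivalently $b \in \Sigma(c,a)$). It is a plane-triad if $a\in\Sigma_{\mathrm{pl}}(b,c)$, $b\in\Sigma_{\mathrm{pl}}(c,a)$, $c\in\Sigma_{\mathrm{pl}}(a,b)$, and a point-triad if the same holds with $\mathrm{pt}$ in place of $\mathrm{pl}$. A plane-tetrad (resp. point-tetrad) is a set $\{o,p,q,r\}$ of four pairwise-incident lines such that each of $\{p,q,r\},\{o,q,r\},\{o,r,p\},\{o,p,q\}$ is a plane-triad (resp. point-triad). The diagonals of a plane-tetrad are the unique lines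 $a\in\mathrm{pt}(o,p)\cap\mathrm{pt}(q,r)$, $b\in\mathrm{pt}(o,q)\cap\mathrm{pt}(r,p)$, $c\in\mathrm{pt}(o,r)\cap\mathrm{pt}(p,q)$; the diagonals of a point-tetrad are the unique lines $a\in\mathrm{pl}(o,p)\cap\mathrm{pl}(q,r)$, $b\in\mathrm{pl}(o,q)\cap\mathrm{pl}(r,p)$, $c\in\mathrm{pl}(o,r)\cap\mathrm{pl}(p,q)$. Axiom [H]: the diagonals of a plane-tetrad form a plane-triad, and the diagonals of a point-tetrad form a point-triad. -}

module Defs where

open import Data.Product using (Σ; ∃; ∃-syntax; _×_; _,_)
open import Data.Sum using (_⊎_)
open import Data.Empty using (⊥)
open import Relation.Nullary using (¬_)
open import Relation.Binary.PropositionalEquality using (_≡_; _≢_)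

-- The raw data of a "linear" space: a set of lines, an incidence relation,
-- and the labelling of the two incidence classes of Σ(a,b):
-- `Lab a b c` means  c ∈ Σ_pt(a,b)  (the remaining elements of Σ(a,b)
-- form Σ_pl(a,b)).
module Geometry {Line : Set} (_∼_ : Line → Line → Set)
                (Lab : Line → Line → Line → Set) where

  Skew : Line → Line → Set
  Skew x y = ¬ (x ∼ y)

  In2 : Line → Line → Line → Set
  In2 a b x = (a ∼ x) × (b ∼ x)

  In3 : Line → Line → Line → Line → Set
  In3 a b c x = (a ∼ x) × (b ∼ x) × (c ∼ x)

  InPerp2 : Line → Line → Line → Set
  InPerp2 a b x = ∀ y → In2 a b y → y ∼ x

  IsPair : Line → Line → Set
  IsPair a b = (a ≢ b) × (a ∼ b)

  InΣ : Line → Line → Line → Set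
  InΣ a b c = IsPair a b × In2 a b c × ¬ InPerp2 a b c

  InΣpt : Line → Line → Line → Set
  InΣpt a b c = InΣ a b c × Lab a b c

  InΣpl : Line → Line → Line → Set
  InΣpl a b c = InΣ a b c × ¬ Lab a b c

  InPt : Line → Line → Line → Set
  InPt a b x = ∃[ c ] (InΣpt a b c × In3 a b c x)

  InPl : Line → Line → Line → Set
  InPl a b x = ∃[ c ] (InΣpl a b c × In3 a b c x)

  IsPoint : (Line → Set) → Set
  IsPoint X = ∃[ a ] ∃[ b ] (IsPair a b ×
                (∀ x → (X x → InPt a b x) × (InPt a b x → X x)))

  IsPlane : (Line → Set) → Set
  IsPlane X = ∃[ a ] ∃[ b ] (IsPair a b ×
                (∀ x → (X x → InPl a b x) × (InPl a b x → X x)))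

  Meet : (Line → Set) → (Line → Set) → Set
  Meet X Y = ∃[ x ] (X x × Y x)

  Collinear3 : (Line → Set) → (Line → Set) → (Line → Set) → Set
  Collinear3 X Y Z = ∃[ l ] (X l × Y l × Z l)

  Coplanar4 : (Line → Set) → (Line → Set) → (Line → Set) → (Line → Set) → Set
  Coplanar4 O P Q R = ∃[ a ] ∃[ b ] (IsPair a b ×
    Meet (InPl a b) O × Meet (InPl a b) P × Meet (InPl a b) Q × Meet (InPl a b) R)

  CompleteQuadrangle : (Line → Set) → (Line → Set) → (Line → Set) → (Line → Set) → Set
  CompleteQuadrangle O P Q R =
    IsPoint O × IsPoint P × IsPoint Q × IsPoint R × Coplanar4 O P Q R ×
    ¬ Collinear3 O P Q × ¬ Collinear3 O P R × ¬ Collinear3 O Q R × ¬ Collinear3 P Q R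

  PlaneTriad : Line → Line → Line → Set
  PlaneTriad a b c = (a ∼ b) × (b ∼ c) × (c ∼ a) ×
                     InΣpl b c a × InΣpl c a b × InΣpl a b c

  PointTriad : Line → Line → Line → Set
  PointTriad a b c = (a ∼ b) × (b ∼ c) × (c ∼ a) ×
                     InΣpt b c a × InΣpt c a b × InΣpt a b c

  PlaneTetrad : Line → Line → Line → Line → Set
  PlaneTetrad o p q r = PlaneTriad p q r × PlaneTriad o q r × PlaneTriad o r p × PlaneTriad o p q

  PointTetrad : Line → Line → Line → Line → Set
  PointTetrad o p q r = PointTriad p q r × PointTriad o q r × PointTriad o r p × PointTriad o p q

  -- Axioms [1]-[4], [H], together with the structural facts stated in the context
  -- (incidence is an equivalence on Σ(a,b) with the two labelled classes, and
  -- pt(a,b), pl(a,b) are independent of the representative c).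
  record Axioms : Set where
    field
      ∼-refl : ∀ l → l ∼ l
      ∼-sym  : ∀ {l m} → l ∼ m → m ∼ l
      ax1    : ∀ l → ∃[ x ] ∃[ y ] ∃[ z ] ((l ∼ x) × (l ∼ y) × (l ∼ z) ×
                 Skew x y × Skew y z × Skew x z)
      ax2-1  : ∀ a b → IsPair a b → ∃[ x ] ∃[ y ] (In2 a b x × In2 a b y × Skew x y)
      ax2-2  : ∀ a b c → InΣ a b c → ∀ x y → In3 a b c x → In3 a b c y → x ∼ y
      ax2-3  : ∀ a b x y → IsPair a b → In2 a b x → In2 a b y → Skew x y →
                 ∀ z → In2 a b z → In3 a b x z ⊎ In3 a b y z
      ax3    : ∀ a b c → InΣ a b c →
                 ∃[ p ] ∃[ q ] ∃[ r ] (InΣ p q r × (∀ x → In3 a b c x → In3 p q r x → ⊥))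
      pt-nonempty : ∀ a b → IsPair a b → ∃[ c ] InΣpt a b c
      pl-nonempty : ∀ a b → IsPair a b → ∃[ c ] InΣpl a b c
      pt-class    : ∀ a b c d → InΣpt a b c → InΣpt a b d → c ∼ d
      pl-class    : ∀ a b c d → InΣpl a b c → InΣpl a b d → c ∼ d
      pt-pl-skew  : ∀ a b c d → InΣpt a b c → InΣpl a b d → Skew c d
      pt-wd : ∀ a b c c' → InΣpt a b c → InΣpt a b c' → ∀ x → In3 a b c x → In3 a b c' x
      pl-wd : ∀ a b c c' → InΣpl a b c → InΣpl a b c' → ∀ x → In3 a b c x → In3 a b c' x
      ax4    : ∀ a b p q → IsPair a b → IsPair p q →
                 (∃[ x ] (InPt a b x × InPt p q x)) × (∃[ x ] (InPl a b x × InPl p q x))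
      axH-plane : ∀ o p q r a b c → PlaneTetrad o p q r →
                    InPt o p a → InPt q r a → InPt o q b → InPt r p b →
                    InPt o r c → InPt p q c → PlaneTriad a b c
      axH-point : ∀ o p q r a b c → PointTetrad o p q r →
                    InPl o p a → InPl q r a → InPl o q b → InPl r p b →
                    InPl o r c → InPl p q c → PointTriad a b c

-- The four sides OP, OQ, RP, QR of the quadrangle pairwise meet in the six
-- points O, P, Q, R, A, B, and no three of them pass through one point, so
-- they form a plane-tetrad whose diagonals are OR, PQ and AB.  By Axiom [H]
-- these diagonals form a plane-triad, so AB ∈ Σ_pl(OR, PQ).  If AB passed
-- through C = pt(OR, PQ) it would be incident with the lines of Σ_pt(OR, PQ),
-- which are skew to those of Σ_pl(OR, PQ).
--
-- The basic tool is that a point is pt(x, y) for any two distinct lines x, y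
-- on it: otherwise a line of the point lies in Σ_pl(x, y), the whole point
-- lies in the plane pl(x, y), and Axioms [3] and [4] forbid that.  This is
-- proved by contradiction, so memberships in points are only obtained up to
-- double negation, which suffices because the theorem is a negation.
module Submission where

open import Defs
open import Data.Product using (_,_; proj₁; proj₂)
open import Effect.Monad using (RawMonad)
open import Level using (0ℓ)
open import Relation.Nullary using (¬_)
open import Relation.Nullary.Negation using (¬¬-Monad)
open import Relation.Binary.PropositionalEquality using (_≢_; ≢-sym; sym; subst)

module LinearSpace {Line : Set} (_∼_ : Line → Line → Set) (Lab : Line → Line → Line → Set)
  (ax : Geometry.Axioms _∼_ Lab) where
  open Geometry _∼_ Lab
  open Axioms ax
  open RawMonad (¬¬-Monad {0ℓ})

  In3-of-InPt : ∀ {a b c x} → InΣpt a b c → InPt a b x → In3 a b c x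
  In3-of-InPt {a} {b} {c} c∈ (d , d∈ , x∈) = pt-wd a b d c d∈ c∈ _ x∈

  In3-of-InPl : ∀ {a b c x} → InΣpl a b c → InPl a b x → In3 a b c x
  In3-of-InPl {a} {b} {c} c∈ (d , d∈ , x∈) = pl-wd a b d c d∈ c∈ _ x∈

  InPt-incident : ∀ {a b s t} → InPt a b s → InPt a b t → s ∼ t
  InPt-incident {a} {b} {s} {t} (c , c∈ , s∈) t∈ =
    ax2-2 a b c (proj₁ c∈) s t s∈ (In3-of-InPt c∈ t∈)

  InPt-left : ∀ {a b} → IsPair a b → InPt a b a
  InPt-left {a} {b} ab with pt-nonempty a b ab
  ... | c , c∈@((_ , (a∼c , _) , _) , _) = c , c∈ , ∼-refl a , ∼-sym (proj₂ ab) , ∼-sym a∼c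

  InPt-right : ∀ {a b} → IsPair a b → InPt a b b
  InPt-right {a} {b} ab with pt-nonempty a b ab
  ... | c , c∈@((_ , (_ , b∼c) , _) , _) = c , c∈ , proj₂ ab , ∼-refl b , ∼-sym b∼c

  ¬InPt-of-InΣpl : ∀ {a b c} → InΣpl a b c → ¬ InPt a b c
  ¬InPt-of-InΣpl {a} {b} {c} c∈ (d , d∈ , (_ , _ , d∼c)) = pt-pl-skew a b d c d∈ c∈ d∼c

  InΣpl-of-¬InPt : ∀ {a b c} → IsPair a b → In2 a b c → ¬ InPt a b c → InΣpl a b c
  InΣpl-of-¬InPt {a} {b} {c} ab c∈ c∉ = (ab , c∈ , c∉⊥) , c∉pt
    where
    c∉⊥ : ¬ InPerp2 a b c
    c∉⊥ c∈⊥ with pt-nonempty a b ab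
    ... | d , d∈@((_ , d∈ab , _) , _) = c∉ (d , d∈ , proj₁ c∈ , proj₂ c∈ , c∈⊥ d d∈ab)
    c∉pt : ¬ Lab a b c
    c∉pt lab = c∉ (c , ((ab , c∈ , c∉⊥) , lab) , proj₁ c∈ , proj₂ c∈ , ∼-refl c)

  -- Axiom [3] gives a triad span [pqr] missing [xyw]; it is pt(p, q) or
  -- pl(p, q), and Axiom [4] makes it meet pt(a, b) or pl(x, y) = [xyw].
  point-⊄-plane : ∀ {a b x y w} → IsPair a b → InΣpl x y w →
                  ¬ (∀ t → InPt a b t → In3 x y w t)
  point-⊄-plane {a} {b} {x} {y} {w} ab w∈ pt⊆ with ax3 x y w (proj₁ w∈)
  ... | p , q , r , r∈ , disjoint = r∉pl r∉pt
    where
    r∉pt : ¬ Lab p q r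
    r∉pt lab with proj₁ (ax4 a b p q ab (proj₁ r∈))
    ... | t , t∈ab , t∈pq = disjoint t (pt⊆ t t∈ab) (In3-of-InPt (r∈ , lab) t∈pq)
    r∉pl : ¬ ¬ Lab p q r
    r∉pl ¬lab with proj₂ (ax4 x y p q (proj₁ (proj₁ w∈)) (proj₁ r∈))
    ... | t , t∈xy , t∈pq = disjoint t (In3-of-InPl w∈ t∈xy) (In3-of-InPl (r∈ , ¬lab) t∈pq)

  pt⊆pt : ∀ {a b x y w} → IsPair a b → x ≢ y →
          InPt a b x → InPt a b y → InPt a b w → ¬ ¬ InPt x y w
  pt⊆pt {x = x} {y} {w} ab x≢y x∈ y∈ w∈ w∉ =
    point-⊄-plane ab (InΣpl-of-¬InPt (x≢y , InPt-incident x∈ y∈) (x∼w , y∼w) w∉)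
      (λ t t∈ → InPt-incident x∈ t∈ , InPt-incident y∈ t∈ , InPt-incident w∈ t∈)
    where
    x∼w : x ∼ w
    x∼w = InPt-incident x∈ w∈
    y∼w : y ∼ w
    y∼w = InPt-incident y∈ w∈

  point-incident : ∀ {X s t} → IsPoint X → X s → X t → s ∼ t
  point-incident (a , b , ab , X≡pt) s∈ t∈ =
    InPt-incident (proj₁ (X≡pt _) s∈) (proj₁ (X≡pt _) t∈)

  point⊆pt : ∀ {X x y w} → IsPoint X → x ≢ y → X x → X y → X w → ¬ ¬ InPt x y w
  point⊆pt (a , b , ab , X≡pt) x≢y x∈ y∈ w∈ =
    pt⊆pt ab x≢y (proj₁ (X≡pt _) x∈) (proj₁ (X≡pt _) y∈) (proj₁ (X≡pt _) w∈)

  pt⊆point : ∀ {X x y z} → IsPoint X → x ≢ y → X x → X y → InPt x y z → ¬ ¬ X z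
  pt⊆point (a , b , ab , X≡pt) x≢y x∈ y∈ z∈ = do
    let x∈ab = proj₁ (X≡pt _) x∈
        y∈ab = proj₁ (X≡pt _) y∈
    a∈xy ← pt⊆pt ab x≢y x∈ab y∈ab (InPt-left ab)
    b∈xy ← pt⊆pt ab x≢y x∈ab y∈ab (InPt-right ab)
    z∈ab ← pt⊆pt (x≢y , InPt-incident x∈ab y∈ab) (proj₁ ab) a∈xy b∈xy z∈
    pure (proj₂ (X≡pt _) z∈ab)

  points-sharing-two-lines : ∀ {X Y x y z} → IsPoint X → IsPoint Y → x ≢ y →
                             X x → X y → Y x → Y y → Y z → ¬ ¬ X z
  points-sharing-two-lines X Y x≢y x∈X y∈X x∈Y y∈Y z∈Y =
    point⊆pt Y x≢y x∈Y y∈Y z∈Y >>= pt⊆point X x≢y x∈X y∈X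

  InΣpl-off-point : ∀ {X x y z} → IsPoint X → x ≢ y → X x → X y →
                    x ∼ z → y ∼ z → ¬ X z → InΣpl x y z
  InΣpl-off-point X x≢y x∈ y∈ x∼z y∼z z∉ =
    InΣpl-of-¬InPt (x≢y , point-incident X x∈ y∈) (x∼z , y∼z)
      (λ z∈ → pt⊆point X x≢y x∈ y∈ z∈ z∉)

  distinct-by : ∀ {X : Line → Set} {l m} → X l → ¬ X m → m ≢ l
  distinct-by {X} l∈ m∉ m≡l = m∉ (subst X (sym m≡l) l∈)

  plane-triad-of-triangle : ∀ {X Y Z a b c} → IsPoint X → IsPoint Y → IsPoint Z →
    X a → X b → Y b → Y c → Z c → Z a → ¬ X c → ¬ Y a → ¬ Z b → PlaneTriad a b c
  plane-triad-of-triangle {a = a} {b} {c} X Y Z a∈X b∈X b∈Y c∈Y c∈Z a∈Z c∉X a∉Y b∉Z =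
    a∼b , b∼c , c∼a ,
    InΣpl-off-point Y b≢c b∈Y c∈Y (∼-sym a∼b) c∼a a∉Y ,
    InΣpl-off-point Z c≢a c∈Z a∈Z (∼-sym b∼c) a∼b b∉Z ,
    InΣpl-off-point X a≢b a∈X b∈X (∼-sym c∼a) b∼c c∉X
    where
    a∼b : a ∼ b
    a∼b = point-incident X a∈X b∈X
    b∼c : b ∼ c
    b∼c = point-incident Y b∈Y c∈Y
    c∼a : c ∼ a
    c∼a = point-incident Z c∈Z a∈Z
    a≢b : a ≢ b
    a≢b = distinct-by b∈Y a∉Y
    b≢c : b ≢ c
    b≢c = distinct-by c∈Z b∉Z
    c≢a : c ≢ a
    c≢a = distinct-by a∈X c∉X

  plane-triad-not-concurrent : ∀ {X a b c} → PlaneTriad a b c → IsPoint X →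
                               X a → X b → ¬ X c
  plane-triad-not-concurrent (_ , _ , _ , _ , _ , c∈Σpl) X a∈ b∈ c∈ =
    point⊆pt X (proj₁ (proj₁ (proj₁ c∈Σpl))) a∈ b∈ c∈ (¬InPt-of-InΣpl c∈Σpl)

  module DiagonalPoints
    (O P Q R A B C : Line → Set)
    (O-pt : IsPoint O) (P-pt : IsPoint P) (Q-pt : IsPoint Q) (R-pt : IsPoint R)
    (¬OPQ : ¬ Collinear3 O P Q) (¬OPR : ¬ Collinear3 O P R)
    (¬OQR : ¬ Collinear3 O Q R) (¬PQR : ¬ Collinear3 P Q R)
    (A-pt : IsPoint A) (B-pt : IsPoint B) (C-pt : IsPoint C)
    (lOP lQR lOQ lRP lOR lPQ : Line)
    (O-OP : O lOP) (P-OP : P lOP) (Q-QR : Q lQR) (R-QR : R lQR) (A-OP : A lOP) (A-QR : A lQR)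
    (O-OQ : O lOQ) (Q-OQ : Q lOQ) (R-RP : R lRP) (P-RP : P lRP) (B-OQ : B lOQ) (B-RP : B lRP)
    (O-OR : O lOR) (R-OR : R lOR) (P-PQ : P lPQ) (Q-PQ : Q lPQ) (C-OR : C lOR) (C-PQ : C lPQ)
    where

    O∉RP : ¬ O lRP
    O∉RP O-RP = ¬OPR (lRP , O-RP , P-RP , R-RP)
    O∉QR : ¬ O lQR
    O∉QR O-QR = ¬OQR (lQR , O-QR , Q-QR , R-QR)
    P∉OQ : ¬ P lOQ
    P∉OQ P-OQ = ¬OPQ (lOQ , O-OQ , P-OQ , Q-OQ)
    P∉QR : ¬ P lQR
    P∉QR P-QR = ¬PQR (lQR , P-QR , Q-QR , R-QR)
    Q∉OP : ¬ Q lOP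
    Q∉OP Q-OP = ¬OPQ (lOP , O-OP , P-OP , Q-OP)
    Q∉RP : ¬ Q lRP
    Q∉RP Q-RP = ¬PQR (lRP , P-RP , Q-RP , R-RP)
    R∉OP : ¬ R lOP
    R∉OP R-OP = ¬OPR (lOP , O-OP , P-OP , R-OP)
    R∉OQ : ¬ R lOQ
    R∉OQ R-OQ = ¬OQR (lOQ , O-OQ , Q-OQ , R-OQ)

    OP≢OQ : lOP ≢ lOQ
    OP≢OQ = distinct-by Q-OQ Q∉OP
    OP≢RP : lOP ≢ lRP
    OP≢RP = distinct-by R-RP R∉OP
    OP≢QR : lOP ≢ lQR
    OP≢QR = distinct-by R-QR R∉OP
    OQ≢RP : lOQ ≢ lRP
    OQ≢RP = distinct-by R-RP R∉OQ
    OQ≢QR : lOQ ≢ lQR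
    OQ≢QR = distinct-by R-QR R∉OQ
    RP≢QR : lRP ≢ lQR
    RP≢QR = distinct-by Q-QR Q∉RP

    A∉OQ : ¬ A lOQ
    A∉OQ A-OQ = points-sharing-two-lines O-pt A-pt OP≢OQ O-OP O-OQ A-OP A-OQ A-QR O∉QR
    A∉RP : ¬ A lRP
    A∉RP A-RP = points-sharing-two-lines P-pt A-pt OP≢RP P-OP P-RP A-OP A-RP A-QR P∉QR
    B∉OP : ¬ B lOP
    B∉OP B-OP = points-sharing-two-lines O-pt B-pt OP≢OQ O-OP O-OQ B-OP B-OQ B-RP O∉RP
    B∉QR : ¬ B lQR
    B∉QR B-QR = points-sharing-two-lines Q-pt B-pt OQ≢QR Q-OQ Q-QR B-OQ B-QR B-RP Q∉RP

    sides-tetrad : PlaneTetrad lOP lOQ lRP lQR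
    sides-tetrad =
      plane-triad-of-triangle B-pt R-pt Q-pt B-OQ B-RP R-RP R-QR Q-QR Q-OQ B∉QR R∉OQ Q∉RP ,
      plane-triad-of-triangle P-pt R-pt A-pt P-OP P-RP R-RP R-QR A-QR A-OP P∉QR R∉OP A∉RP ,
      plane-triad-of-triangle A-pt Q-pt O-pt A-OP A-QR Q-QR Q-OQ O-OQ O-OP A∉OQ Q∉OP O∉QR ,
      plane-triad-of-triangle O-pt B-pt P-pt O-OP O-OQ B-OQ B-RP P-RP P-OP O∉RP B∉OP P∉OQ

    diagonals-triad : ∀ {ℓ} → A ℓ → B ℓ → ¬ ¬ PlaneTriad lOR lPQ ℓ
    diagonals-triad A-ℓ B-ℓ = do
      OR∈O ← point⊆pt O-pt OP≢OQ O-OP O-OQ O-OR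
      OR∈R ← point⊆pt R-pt RP≢QR R-RP R-QR R-OR
      PQ∈P ← point⊆pt P-pt OP≢RP P-OP P-RP P-PQ
      PQ∈Q ← point⊆pt Q-pt (≢-sym OQ≢QR) Q-QR Q-OQ Q-PQ
      ℓ∈A ← point⊆pt A-pt OP≢QR A-OP A-QR A-ℓ
      ℓ∈B ← point⊆pt B-pt OQ≢RP B-OQ B-RP B-ℓ
      pure (axH-plane lOP lOQ lRP lQR lOR lPQ _ sides-tetrad OR∈O OR∈R PQ∈P PQ∈Q ℓ∈A ℓ∈B)

    diagonal-points-not-collinear : ¬ Collinear3 A B C
    diagonal-points-not-collinear (ℓ , A-ℓ , B-ℓ , C-ℓ) =
      diagonals-triad A-ℓ B-ℓ λ triad → plane-triad-not-concurrent triad C-pt C-OR C-PQ C-ℓ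

theorem4 : {Line : Set} (_∼_ : Line → Line → Set) (Lab : Line → Line → Line → Set) →
    Geometry.Axioms _∼_ Lab →
    (O P Q R A B C : Line → Set) →
    Geometry.CompleteQuadrangle _∼_ Lab O P Q R →
    Geometry.IsPoint _∼_ Lab A → Geometry.IsPoint _∼_ Lab B → Geometry.IsPoint _∼_ Lab C →
    (lOP lQR lOQ lRP lOR lPQ : Line) →
    O lOP → P lOP → Q lQR → R lQR → A lOP → A lQR →
    O lOQ → Q lOQ → R lRP → P lRP → B lOQ → B lRP →
    O lOR → R lOR → P lPQ → Q lPQ → C lOR → C lPQ →
    ¬ Geometry.Collinear3 _∼_ Lab A B C
theorem4 _∼_ Lab ax O P Q R A B C (O-pt , P-pt , Q-pt , R-pt , _ , ¬OPQ , ¬OPR , ¬OQR , ¬PQR) =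
  LinearSpace.DiagonalPoints.diagonal-points-not-collinear _∼_ Lab ax
    O P Q R A B C O-pt P-pt Q-pt R-pt ¬OPQ ¬OPR ¬OQR ¬PQR
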